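{- In LP$^{\mathrm{MLN}}$ (i.e. with respect to semi-strong equivalence $\equiv_{s,s}$), the S-DL transformation is SE-preserving: for every pair $T=\langle P,Q\rangle$ of programs with $P\equiv_{s,s}Q$, every independent set $I$ of $T$ with $|I|\ge 3$ and every $a\in I$, the pair $\langle P^-,Q^-\rangle$ obtained from $T$ by deleting $a$ from $I$ satisfies $P^-\equiv_{s,s}Q^-$.
   Context: Atoms are propositional. A rule $r$ is an expression $h_1\vee\cdots\vee h_k\leftarrow b_1,\dots,b_m,\mathit{not}\,c_1,\dots,\mathit{not}\,c_n$; write $H(r)$, $B^+(r)$, $B^-(r)$ for the sets of head, positive body and negative body atoms. A program is a finite set of rules. An interpretation $X$ (set of atoms) satisfies $r$ iff $X\cap H(r)\neq\emptyset$ or $B^+(r)\not\subseteq X$ or $B^-(r)\cap X\neq\emptyset$. GL-reduct $P^X=\{H(r)\leftarrow B^+(r) : r\in P,\ B^-(r)\cap X=\emptyset\}$; $X$ is an ASP stable model of $P$ iff $X\models P^X$ and no proper subset of $X$ satisfies $P^X$. Weights of LP$^{\mathrm{MLN}}$ rules are omitted; $X$ is an LP$^{\mathrm{MLN}}$ stable model of $P$ iff $X$ is an ASP stable model of $\{r\in P: X\models r\}$. $P\equiv_{s,s}Q$ iff for every program $R$, $P\cup R$ and $Q\cup R$ have the same LP$^{\mathrm{MLN}}$ stable models. Programs are regarded as tuples of rules; $\langle P,Q\rangle$ is the concatenation of $P$ and $Q$. For a tuple $T=\langle r_1,\dots,r_n\rangle$ let $\langle S_1,\dots,S_{3n}\rangle=\langle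 H(r_1),B^+(r_1),B^-(r_1),\dots,H(r_n),B^+(r_n),B^-(r_n)\rangle$. For nonempty $N'\subseteq\{1,\dots,3n\}$ the independent set is $I_{N'}=\bigcap_{i\in N'}S_i\setminus\bigcup_{j\notin N'}S_j$. Deleting $a\in I$ from $I$ means removing the atom $a$ from every rule of $T$; the resulting tuple is split as $\langle P^-,Q^-\rangle$ with $P^-$ the first $|P|$ rules. -}

module Defs where

open import Data.Nat using (ℕ; _≟_)
open import Data.Bool using (Bool; true; false)
open import Data.List using (List; []; _∷_; _++_; filter; map; concatMap; length; lookup; take)
open import Data.List.Membership.Propositional using (_∈_; _∉_)
open import Data.List.Membership.DecPropositional _≟_ using (_∈?_)
open import Data.List.Relation.Unary.Any using (Any; any?)
open import Data.List.Relation.Unary.All using (All; all?)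
open import Data.Product using (Σ; ∃; _×_; _,_)
open import Data.Sum using (_⊎_)
open import Data.Fin using (Fin)
import Data.Fin.Subset as FS
open import Function.Bundles using (_⇔_)
open import Relation.Nullary using (¬_; Dec)
open import Relation.Nullary.Decidable using (¬?; _⊎-dec_)
open import Relation.Binary.PropositionalEquality using (_≢_)

Atom : Set
Atom = ℕ

-- A rule  h₁ ∨ … ∨ hₖ ← b₁,…,bₘ, not c₁,…,not cₙ
record Rule : Set where
  constructor rule
  field
    H  : List Atom
    B⁺ : List Atom
    B⁻ : List Atom
open Rule public

Program : Set
Program = List Rule

Interp : Set
Interp = List Atom

_⊆_ : Interp → Interp → Set
Y ⊆ X = ∀ {a} → a ∈ Y → a ∈ X

_⊨_ : Interp → Rule → Set
X ⊨ r = Any (_∈ X) (H r) ⊎ (Any (_∉ X) (B⁺ r) ⊎ Any (_∈ X) (B⁻ r))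

_⊨?_ : (X : Interp) (r : Rule) → Dec (X ⊨ r)
X ⊨? r = any? (_∈? X) (H r) ⊎-dec (any? (λ b → ¬? (b ∈? X)) (B⁺ r) ⊎-dec any? (_∈? X) (B⁻ r))

_⊨⁺_ : Interp → Rule → Set
Y ⊨⁺ r = Any (_∈ Y) (H r) ⊎ Any (_∉ Y) (B⁺ r)

-- Y ⊨ P^X  (the GL-reduct: rules with B⁻(r) ∩ X = ∅, with negative body dropped)
SatReduct : Interp → Program → Interp → Set
SatReduct Y P X = All (λ r → All (_∉ X) (B⁻ r) → Y ⊨⁺ r) P

ASPStable : Program → Interp → Set
ASPStable P X = SatReduct X P X × (∀ Y → Y ⊆ X → ¬ (X ⊆ Y) → ¬ SatReduct Y P X)

LPMLNStable : Program → Interp → Set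
LPMLNStable P X = ASPStable (filter (X ⊨?_) P) X

_≡ss_ : Program → Program → Set
P ≡ss Q = ∀ (R : Program) (X : Interp) → LPMLNStable (P ++ R) X ⇔ LPMLNStable (Q ++ R) X

seqS : Program → List (List Atom)
seqS = concatMap (λ r → H r ∷ B⁺ r ∷ B⁻ r ∷ [])

InIndep : (T : Program) → FS.Subset (length (seqS T)) → Atom → Set
InIndep T N' a = ∀ (i : Fin (length (seqS T))) → (a ∈ lookup (seqS T) i) ⇔ (i FS.∈ N')

AtLeast3 : (Atom → Set) → Set
AtLeast3 I = Σ Atom λ b → Σ Atom λ c → Σ Atom λ d →
  I b × I c × I d × b ≢ c × b ≢ d × c ≢ d

delAtom : Atom → List Atom → List Atom
delAtom a = filter (λ x → ¬? (x ≟ a))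

delRule : Atom → Rule → Rule
delRule a r = rule (delAtom a (H r)) (delAtom a (B⁺ r)) (delAtom a (B⁻ r))

delProg : Atom → Program → Program
delProg a = map (delRule a)

-- Since a and b lie in the same independent set and b ≢ a, b occurs in every position of every
-- rule where a does. On interpretations in which a and b have the same truth value, deleting a
-- therefore does not change the truth of any rule, and the stable models of P ∪ {a ← b, b ← a}
-- are exactly those of P⁻, with a added whenever b holds. Given a context R, first swap a with a
-- fresh atom in R and in the candidate model, so that a occurs only in P and Q; then the stable
-- models of P⁻ ∪ R and Q⁻ ∪ R are those of P ∪ R ∪ {a ← b, b ← a} and Q ∪ R ∪ {a ← b, b ← a},
-- which coincide because P ≡ss Q.
module Submission where

open import Defs
open import Data.Nat using (suc; _≤_; _≟_)
open import Data.List using (List; []; _∷_; _++_; [_]; length; take; drop; map; filter; lookup)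
open import Data.List.Properties using (map-++; map-id-local; filter-all; ++-assoc)
open import Data.List.Extrema.Nat using (max; xs≤max)
open import Data.List.Membership.Propositional using (_∈_; _∉_; find; lose)
open import Data.List.Membership.Propositional.Properties using (∈-map⁺; ∈-map⁻; ∈-filter⁺; ∈-filter⁻)
open import Data.List.Membership.DecPropositional _≟_ using (_∈?_)
open import Data.List.Relation.Unary.Any using (Any; here; there)
open import Data.List.Relation.Unary.All as All using (All; []; _∷_)
import Data.List.Relation.Unary.All.Properties as AllP
import Data.List.Relation.Binary.Subset.Propositional.Properties as Subset
open import Data.Fin using (zero; suc)
open import Data.Fin.Subset using (Subset; Nonempty)
open import Data.Nat.Properties using (1+n≰n)
open import Data.Product using (∃-syntax; _×_; _,_; proj₁; proj₂)
import Data.Sum as Sum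
open import Data.Sum using (inj₁; inj₂)
open import Data.Empty using (⊥-elim)
open import Function using (_∘_)
open import Function.Bundles using (_⇔_; mk⇔; Equivalence)
import Function.Properties.Equivalence as ⇔
open import Relation.Nullary using (¬_; yes; no)
open import Relation.Nullary.Decidable using (¬?; does; dec-true; dec-false)
open import Data.Bool using (if_then_else_)
open import Relation.Unary using (Decidable)
open import Relation.Binary.PropositionalEquality using (_≡_; _≢_; refl; sym; trans; cong; cong₂; subst; subst₂)

open Equivalence using (to; from)

private variable
  X X' Y Y' Z Z' : Interp
  S S' : List Atom
  r r' : Rule
  A P Q R : Program

All-filter⇔ : ∀ {C : Set} {p q : C → Set} (p? : Decidable p) xs →
              All q (filter p? xs) ⇔ All (λ x → p x → q x) xs
All-filter⇔ p? [] = mk⇔ (λ _ → []) (λ _ → [])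
All-filter⇔ p? (x ∷ xs) with p? x
... | yes px = mk⇔ (λ { (qx ∷ qs) → (λ _ → qx) ∷ to (All-filter⇔ p? xs) qs })
                   (λ { (f ∷ fs) → f px ∷ from (All-filter⇔ p? xs) fs })
... | no ¬px = mk⇔ (λ qs → (λ px → ⊥-elim (¬px px)) ∷ to (All-filter⇔ p? xs) qs)
                   (λ { (_ ∷ fs) → from (All-filter⇔ p? xs) fs })

ReductHolds : Interp → Interp → Rule → Set
ReductHolds Y X r = X ⊨ r → All (_∉ X) (B⁻ r) → Y ⊨⁺ r

SatMLNReduct : Interp → Program → Interp → Set
SatMLNReduct Y A X = All (ReductHolds Y X) A

MLNStable : Program → Interp → Set
MLNStable A X = SatMLNReduct X A X × (∀ Y → Y ⊆ X → ¬ X ⊆ Y → ¬ SatMLNReduct Y A X)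

LPMLNStable⇔MLNStable : ∀ A X → LPMLNStable A X ⇔ MLNStable A X
LPMLNStable⇔MLNStable A X = mk⇔
  (λ (sat , minimal) → to (reduct X) sat , λ Y Y⊆X X⊈Y → minimal Y Y⊆X X⊈Y ∘ from (reduct Y))
  (λ (sat , minimal) → from (reduct X) sat , λ Y Y⊆X X⊈Y → minimal Y Y⊆X X⊈Y ∘ to (reduct Y))
  where
  reduct : ∀ Y → SatReduct Y (filter (X ⊨?_) A) X ⇔ SatMLNReduct Y A X
  reduct Y = All-filter⇔ (X ⊨?_) A

≡ss⇒MLNStable : P ≡ss Q → ∀ R X → MLNStable (P ++ R) X → MLNStable (Q ++ R) X
≡ss⇒MLNStable {P} {Q} P≡Q R X =
  to (LPMLNStable⇔MLNStable (Q ++ R) X) ∘ to (P≡Q R X) ∘ from (LPMLNStable⇔MLNStable (P ++ R) X)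

≡ss-sym : P ≡ss Q → Q ≡ss P
≡ss-sym P≡Q R X = ⇔.sym (P≡Q R X)

-- The truth of a rule depends only on which truth values occur in each of its three lists,
-- so lists whose atoms can be paired off with equal truth values behave alike.
Covers : Interp → List Atom → Interp → List Atom → Set
Covers Y S Y' S' = ∀ {x} → x ∈ S → ∃[ x' ] x' ∈ S' × (x ∈ Y ⇔ x' ∈ Y')

Mirrors : Interp → List Atom → Interp → List Atom → Set
Mirrors Y S Y' S' = Covers Y S Y' S' × Covers Y' S' Y S

Any∈-covered : Covers Y S Y' S' → Any (_∈ Y) S → Any (_∈ Y') S'
Any∈-covered cover any =
  let _ , x∈S , x∈Y = find any
      _ , x'∈S' , x∈Y⇔x'∈Y' = cover x∈S
  in lose x'∈S' (to x∈Y⇔x'∈Y' x∈Y)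

Any∉-covered : Covers Y S Y' S' → Any (_∉ Y) S → Any (_∉ Y') S'
Any∉-covered cover any =
  let _ , x∈S , x∉Y = find any
      _ , x'∈S' , x∈Y⇔x'∈Y' = cover x∈S
  in lose x'∈S' (x∉Y ∘ from x∈Y⇔x'∈Y')

All∉-covered : Covers Y' S' Y S → All (_∉ Y) S → All (_∉ Y') S'
All∉-covered cover all = All.tabulate λ x'∈S' x'∈Y' →
  let _ , x∈S , x'∈Y'⇔x∈Y = cover x'∈S'
  in All.lookup all x∈S (to x'∈Y'⇔x∈Y x'∈Y')

RuleMirrors : Interp → Rule → Interp → Rule → Set
RuleMirrors Y r Y' r' = Mirrors Y (H r) Y' (H r') × Mirrors Y (B⁺ r) Y' (B⁺ r') × Mirrors Y (B⁻ r) Y' (B⁻ r')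

RuleMirrors-sym : RuleMirrors Y r Y' r' → RuleMirrors Y' r' Y r
RuleMirrors-sym ((h , h') , (p , p') , (n , n')) = (h' , h) , (p' , p) , (n' , n)

⊨-mirrored : RuleMirrors X r X' r' → X ⊨ r → X' ⊨ r'
⊨-mirrored ((h , _) , (p , _) , (n , _)) =
  Sum.map (Any∈-covered h) (Sum.map (Any∉-covered p) (Any∈-covered n))

⊨⁺-mirrored : RuleMirrors Y r Y' r' → Y ⊨⁺ r → Y' ⊨⁺ r'
⊨⁺-mirrored ((h , _) , (p , _) , _) = Sum.map (Any∈-covered h) (Any∉-covered p)

ReductHolds-mirrored : RuleMirrors Y r Y' r' → RuleMirrors X r X' r' →
                       ReductHolds Y X r → ReductHolds Y' X' r'
ReductHolds-mirrored mirrorY mirrorX@(_ , _ , (n , _)) holds X'⊨r' B⁻∉X' =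
  ⊨⁺-mirrored mirrorY (holds (⊨-mirrored (RuleMirrors-sym mirrorX) X'⊨r') (All∉-covered n B⁻∉X'))

module _ {g : Rule → Rule} where

  SatMLNReduct-map⁺ : All (λ r → RuleMirrors Y r Y' (g r)) A → All (λ r → RuleMirrors X r X' (g r)) A →
                      SatMLNReduct Y A X → SatMLNReduct Y' (map g A) X'
  SatMLNReduct-map⁺ [] [] [] = []
  SatMLNReduct-map⁺ (mY ∷ mYs) (mX ∷ mXs) (h ∷ hs) = ReductHolds-mirrored mY mX h ∷ SatMLNReduct-map⁺ mYs mXs hs

  SatMLNReduct-map⁻ : All (λ r → RuleMirrors Y r Y' (g r)) A → All (λ r → RuleMirrors X r X' (g r)) A →
                      SatMLNReduct Y' (map g A) X' → SatMLNReduct Y A X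
  SatMLNReduct-map⁻ [] [] [] = []
  SatMLNReduct-map⁻ (mY ∷ mYs) (mX ∷ mXs) (h ∷ hs) =
    ReductHolds-mirrored (RuleMirrors-sym mY) (RuleMirrors-sym mX) h ∷ SatMLNReduct-map⁻ mYs mXs hs

onLists : (List Atom → List Atom) → Rule → Rule
onLists g r = rule (g (H r)) (g (B⁺ r)) (g (B⁻ r))

AllAtoms : (Atom → Set) → Rule → Set
AllAtoms p r = All p (H r) × All p (B⁺ r) × All p (B⁻ r)

map-onLists-id : ∀ {p g} → (∀ {L} → All p L → g L ≡ L) → All (AllAtoms p) A → map (onLists g) A ≡ A
map-onLists-id fix [] = refl
map-onLists-id fix ((pH , pB⁺ , pB⁻) ∷ ps)
  rewrite fix pH | fix pB⁺ | fix pB⁻ | map-onLists-id fix ps = refl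

AllAtoms-onLists : ∀ {p q g} → (∀ {L} → All p L → All q (g L)) →
                        All (AllAtoms p) A → All (AllAtoms q) (map (onLists g) A)
AllAtoms-onLists g⁺ = AllP.map⁺ ∘ All.map (λ (pH , pB⁺ , pB⁻) → g⁺ pH , g⁺ pB⁺ , g⁺ pB⁻)

swap : Atom → Atom → Atom → Atom
swap a f x = if does (x ≟ a) then f else if does (x ≟ f) then a else x

module _ (a f : Atom) where

  swap-a : swap a f a ≡ f
  swap-a rewrite dec-true (a ≟ a) refl = refl

  swap-f : swap a f f ≡ a
  swap-f with f ≟ a
  ... | yes f≡a rewrite dec-true (f ≟ a) f≡a = f≡a
  ... | no f≢a rewrite dec-false (f ≟ a) f≢a | dec-true (f ≟ f) refl = refl

  swap-other : ∀ {x} → x ≢ a → x ≢ f → swap a f x ≡ x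
  swap-other {x} x≢a x≢f rewrite dec-false (x ≟ a) x≢a | dec-false (x ≟ f) x≢f = refl

  swap-involutive : ∀ x → swap a f (swap a f x) ≡ x
  swap-involutive x with x ≟ a | x ≟ f
  ... | yes refl | _        = trans (cong (swap a f) swap-a) swap-f
  ... | no _     | yes refl = trans (cong (swap a f) swap-f) swap-a
  ... | no x≢a   | no x≢f   = trans (cong (swap a f) (swap-other x≢a x≢f)) (swap-other x≢a x≢f)

renameRule : (Atom → Atom) → Rule → Rule
renameRule σ = onLists (map σ)

renameProg : (Atom → Atom) → Program → Program
renameProg σ = map (renameRule σ)

module Renaming {σ : Atom → Atom} (σ-involutive : ∀ x → σ (σ x) ≡ x) where

  σ-injective : ∀ {x y} → σ x ≡ σ y → x ≡ y
  σ-injective {x} {y} σx≡σy = trans (sym (σ-involutive x)) (trans (cong σ σx≡σy) (σ-involutive y))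

  map-involutive : ∀ L → map σ (map σ L) ≡ L
  map-involutive [] = refl
  map-involutive (x ∷ L) = cong₂ _∷_ (σ-involutive x) (map-involutive L)

  renameProg-involutive : ∀ A → renameProg σ (renameProg σ A) ≡ A
  renameProg-involutive [] = refl
  renameProg-involutive (r ∷ A)
    rewrite map-involutive (H r) | map-involutive (B⁺ r) | map-involutive (B⁻ r)
          | renameProg-involutive A = refl

  ∈⇔∈-map : ∀ {x} L → x ∈ L ⇔ σ x ∈ map σ L
  ∈⇔∈-map {x} L = mk⇔ (∈-map⁺ σ) λ σx∈σL →
    let _ , z∈L , σx≡σz = ∈-map⁻ σ σx∈σL in subst (_∈ L) (sym (σ-injective σx≡σz)) z∈L

  Mirrors-map : ∀ Y S → Mirrors Y S (map σ Y) (map σ S)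
  Mirrors-map Y S =
    (λ x∈S → _ , ∈-map⁺ σ x∈S , ∈⇔∈-map Y) ,
    (λ y∈σS → let z , z∈S , y≡σz = ∈-map⁻ σ y∈σS
              in z , z∈S , subst (λ y → y ∈ map σ Y ⇔ z ∈ Y) (sym y≡σz) (⇔.sym (∈⇔∈-map Y)))

  RuleMirrors-rename : ∀ Y r → RuleMirrors Y r (map σ Y) (renameRule σ r)
  RuleMirrors-rename Y r = Mirrors-map Y (H r) , Mirrors-map Y (B⁺ r) , Mirrors-map Y (B⁻ r)

  MLNStable-rename : MLNStable A X → MLNStable (renameProg σ A) (map σ X)
  MLNStable-rename {A} {X} (sat , minimal) =
    SatMLNReduct-map⁺ (mirrors X) (mirrors X) sat ,
    λ Y' Y'⊆σX σX⊈Y' satY' →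
      minimal (map σ Y')
        (subst (map σ Y' ⊆_) (map-involutive X) (Subset.map⁺ σ Y'⊆σX))
        (λ X⊆σY' → σX⊈Y' (subst (map σ X ⊆_) (map-involutive Y') (Subset.map⁺ σ X⊆σY')))
        (SatMLNReduct-map⁻ (mirrors (map σ Y')) (mirrors X)
          (subst (λ Y → SatMLNReduct Y (renameProg σ A) (map σ X)) (sym (map-involutive Y')) satY'))
    where
    mirrors : ∀ Y → All (λ r → RuleMirrors Y r (map σ Y) (renameRule σ r)) A
    mirrors Y = All.universal (RuleMirrors-rename Y) A

  MLNStable-rename⇔ : ∀ A X → MLNStable A X ⇔ MLNStable (renameProg σ A) (map σ X)
  MLNStable-rename⇔ A X = mk⇔ MLNStable-rename λ stable →
    subst₂ MLNStable (renameProg-involutive A) (map-involutive X) (MLNStable-rename stable)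

⊨⁺⇒⊨ : Y ⊨⁺ r → Y ⊨ r
⊨⁺⇒⊨ = Sum.map₂ inj₁

⊨⁺-implication : ∀ {h p} → Y ⊨⁺ rule [ h ] [ p ] [] ⇔ (p ∈ Y → h ∈ Y)
⊨⁺-implication {Y} {h} {p} = mk⇔
  (λ { (inj₁ (here h∈Y)) _ → h∈Y ; (inj₂ (here p∉Y)) p∈Y → ⊥-elim (p∉Y p∈Y) })
  satisfied
  where
  satisfied : (p ∈ Y → h ∈ Y) → Y ⊨⁺ rule [ h ] [ p ] []
  satisfied p⇒h with p ∈? Y
  ... | yes p∈Y = inj₁ (here (p⇒h p∈Y))
  ... | no p∉Y  = inj₂ (here p∉Y)

∈-delAtom⇔ : ∀ {a x} S → x ∈ delAtom a S ⇔ (x ∈ S × x ≢ a)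
∈-delAtom⇔ {a} S = mk⇔ (∈-filter⁻ (λ y → ¬? (y ≟ a))) (λ (x∈S , x≢a) → ∈-filter⁺ (λ y → ¬? (y ≟ a)) x∈S x≢a)

Shadowed : Atom → Atom → Rule → Set
Shadowed a b r = (a ∈ H r → b ∈ H r) × (a ∈ B⁺ r → b ∈ B⁺ r) × (a ∈ B⁻ r → b ∈ B⁻ r)

module Deletion (a b : Atom) (b≢a : b ≢ a) where

  Agree : Interp → Interp → Set
  Agree Y Y' = a ∉ Y' × (∀ {x} → x ≢ a → x ∈ Y ⇔ x ∈ Y') × (a ∈ Y ⇔ b ∈ Y)

  Agree-⊆⇔ : Agree Y Y' → Agree Z Z' → Y ⊆ Z ⇔ Y' ⊆ Z'
  Agree-⊆⇔ {Y} {Y'} {Z} {Z'} (a∉Y' , Y≈Y' , a∈Y⇔b∈Y) (_ , Z≈Z' , a∈Z⇔b∈Z) = mk⇔ shrink grow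
    where
    shrink : Y ⊆ Z → Y' ⊆ Z'
    shrink Y⊆Z x∈Y' = let x≢a = λ { refl → a∉Y' x∈Y' } in to (Z≈Z' x≢a) (Y⊆Z (from (Y≈Y' x≢a) x∈Y'))
    grow : Y' ⊆ Z' → Y ⊆ Z
    grow Y'⊆Z' {x} x∈Y with x ≟ a
    ... | yes refl = from a∈Z⇔b∈Z (from (Z≈Z' b≢a) (Y'⊆Z' (to (Y≈Y' b≢a) (to a∈Y⇔b∈Y x∈Y))))
    ... | no x≢a = from (Z≈Z' x≢a) (Y'⊆Z' (to (Y≈Y' x≢a) x∈Y))

  Mirrors-delete : Agree Y Y' → (a ∈ S → b ∈ S) → Mirrors Y S Y' (delAtom a S)
  Mirrors-delete {Y} {Y'} {S} (_ , Y≈Y' , a∈Y⇔b∈Y) a⇒b = cover , cover⁻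
    where
    cover : Covers Y S Y' (delAtom a S)
    cover {x} x∈S with x ≟ a
    ... | yes refl = b , from (∈-delAtom⇔ S) (a⇒b x∈S , b≢a) , ⇔.trans a∈Y⇔b∈Y (Y≈Y' b≢a)
    ... | no x≢a = x , from (∈-delAtom⇔ S) (x∈S , x≢a) , Y≈Y' x≢a
    cover⁻ : Covers Y' (delAtom a S) Y S
    cover⁻ x∈S' = let x∈S , x≢a = to (∈-delAtom⇔ S) x∈S' in _ , x∈S , ⇔.sym (Y≈Y' x≢a)

  RuleMirrors-delete : Agree Y Y' → Shadowed a b r → RuleMirrors Y r Y' (delRule a r)
  RuleMirrors-delete agree (a⇒bH , a⇒bB⁺ , a⇒bB⁻) =
    Mirrors-delete agree a⇒bH , Mirrors-delete agree a⇒bB⁺ , Mirrors-delete agree a⇒bB⁻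

  Equate : Program
  Equate = rule [ a ] [ b ] [] ∷ rule [ b ] [ a ] [] ∷ []

  SatMLNReduct-Equate⇔ : (a ∈ X ⇔ b ∈ X) → SatMLNReduct Y Equate X ⇔ (a ∈ Y ⇔ b ∈ Y)
  SatMLNReduct-Equate⇔ {X} a∈X⇔b∈X = mk⇔
    (λ { (a←b ∷ b←a ∷ []) → mk⇔ (to ⊨⁺-implication (b←a (X⊨ (to a∈X⇔b∈X)) []))
                                (to ⊨⁺-implication (a←b (X⊨ (from a∈X⇔b∈X)) [])) })
    (λ a∈Y⇔b∈Y → (λ _ _ → from ⊨⁺-implication (from a∈Y⇔b∈Y))
               ∷ (λ _ _ → from ⊨⁺-implication (to a∈Y⇔b∈Y)) ∷ [])
    where
    X⊨ : ∀ {h p} → (p ∈ X → h ∈ X) → X ⊨ rule [ h ] [ p ] []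
    X⊨ = ⊨⁺⇒⊨ ∘ from ⊨⁺-implication

  extend : Interp → Interp
  extend Y with b ∈? Y
  ... | yes _ = a ∷ Y
  ... | no _  = Y

  Agree-extend : a ∉ Y → Agree (extend Y) Y
  Agree-extend {Y} a∉Y with b ∈? Y
  ... | yes b∈Y = a∉Y , (λ x≢a → mk⇔ (λ { (here refl) → ⊥-elim (x≢a refl) ; (there x∈Y) → x∈Y }) there) ,
                  mk⇔ (λ _ → there b∈Y) (λ _ → here refl)
  ... | no b∉Y  = a∉Y , (λ _ → ⇔.refl) , mk⇔ (⊥-elim ∘ a∉Y) (⊥-elim ∘ b∉Y)

  Agree-delAtom : (a ∈ Y ⇔ b ∈ Y) → Agree Y (delAtom a Y)
  Agree-delAtom {Y} a∈Y⇔b∈Y =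
    (λ a∈Y' → proj₂ (to (∈-delAtom⇔ Y) a∈Y') refl) ,
    (λ x≢a → mk⇔ (λ x∈Y → from (∈-delAtom⇔ Y) (x∈Y , x≢a)) (proj₁ ∘ to (∈-delAtom⇔ Y))) ,
    a∈Y⇔b∈Y

  MLNStable-delete⇔ : All (Shadowed a b) A → a ∉ X → MLNStable (delProg a A) X ⇔ MLNStable (A ++ Equate) (extend X)
  MLNStable-delete⇔ {A} {X} shadowed a∉X = mk⇔ forth back
    where
    agreeX = Agree-extend a∉X
    closedX = proj₂ (proj₂ agreeX)

    mirrors : Agree Y Y' → All (λ r → RuleMirrors Y r Y' (delRule a r)) A
    mirrors agree = All.map (RuleMirrors-delete agree) shadowed

    forth : MLNStable (delProg a A) X → MLNStable (A ++ Equate) (extend X)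
    forth (sat , minimal) =
      AllP.++⁺ (SatMLNReduct-map⁻ (mirrors agreeX) (mirrors agreeX) sat) (from (SatMLNReduct-Equate⇔ closedX) closedX) ,
      λ Y Y⊆X⁺ X⁺⊈Y satY →
        let satA , satEquate = AllP.++⁻ A satY
            agreeY = Agree-delAtom (to (SatMLNReduct-Equate⇔ closedX) satEquate)
        in minimal (delAtom a Y) (to (Agree-⊆⇔ agreeY agreeX) Y⊆X⁺) (X⁺⊈Y ∘ from (Agree-⊆⇔ agreeX agreeY))
             (SatMLNReduct-map⁺ (mirrors agreeY) (mirrors agreeX) satA)

    back : MLNStable (A ++ Equate) (extend X) → MLNStable (delProg a A) X
    back (sat , minimal) =
      SatMLNReduct-map⁺ (mirrors agreeX) (mirrors agreeX) (AllP.++⁻ˡ A sat) ,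
      λ Y' Y'⊆X X⊈Y' satY' →
        let agreeY = Agree-extend (a∉X ∘ Y'⊆X)
        in minimal (extend Y') (from (Agree-⊆⇔ agreeY agreeX) Y'⊆X) (X⊈Y' ∘ to (Agree-⊆⇔ agreeX agreeY))
             (AllP.++⁺ (SatMLNReduct-map⁻ (mirrors agreeY) (mirrors agreeX) satY')
                       (from (SatMLNReduct-Equate⇔ closedX) (proj₂ (proj₂ agreeY))))

atoms : Program → List Atom
atoms [] = []
atoms (r ∷ A) = H r ++ B⁺ r ++ B⁻ r ++ atoms A

All-atoms⇒AllAtoms : ∀ {p} A → All p (atoms A) → All (AllAtoms p) A
All-atoms⇒AllAtoms [] _ = []
All-atoms⇒AllAtoms (r ∷ A) ps =
  let pH , ps₁ = AllP.++⁻ (H r) ps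
      pB⁺ , ps₂ = AllP.++⁻ (B⁺ r) ps₁
      pB⁻ , pA = AllP.++⁻ (B⁻ r) ps₂
  in (pH , pB⁺ , pB⁻) ∷ All-atoms⇒AllAtoms A pA

fresh : List Atom → Atom
fresh L = suc (max 0 L)

fresh-≢ : ∀ L → All (_≢ fresh L) L
fresh-≢ L = All.map (λ x≤max x≡fresh → 1+n≰n (subst (λ x → x ≤ max 0 L) x≡fresh x≤max)) (xs≤max 0 L)

module _ {a b : Atom} (b≢a : b ≢ a) where
  open Deletion a b b≢a

  Shadowed-vacuous : All (AllAtoms (_≢ a)) A → All (Shadowed a b) A
  Shadowed-vacuous = All.map λ (≢H , ≢B⁺ , ≢B⁻) → absurd ≢H , absurd ≢B⁺ , absurd ≢B⁻
    where
    absurd : All (_≢ a) S → a ∈ S → b ∈ S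
    absurd ≢S a∈S = ⊥-elim (All.lookup ≢S a∈S refl)

  delProg-vacuous : All (AllAtoms (_≢ a)) A → delProg a A ≡ A
  delProg-vacuous = map-onLists-id {p = _≢ a} (filter-all (λ y → ¬? (y ≟ a)))

  delProg-MLNStable-a-free : P ≡ss Q → All (Shadowed a b) P → All (Shadowed a b) Q →
                             All (AllAtoms (_≢ a)) R → a ∉ X →
                             MLNStable (delProg a P ++ R) X → MLNStable (delProg a Q ++ R) X
  delProg-MLNStable-a-free {P} {Q} {R} {X} P≡Q shadowedP shadowedQ a-free a∉X =
    from (via Q shadowedQ) ∘ ≡ss⇒MLNStable {P} {Q} P≡Q (R ++ Equate) (extend X) ∘ to (via P shadowedP)
    where
    via : ∀ T → All (Shadowed a b) T → MLNStable (delProg a T ++ R) X ⇔ MLNStable (T ++ R ++ Equate) (extend X)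
    via T shadowedT =
      subst₂ (λ A B → MLNStable A X ⇔ MLNStable B (extend X))
        (trans (map-++ (delRule a) T R) (cong (delProg a T ++_) (delProg-vacuous a-free)))
        (++-assoc T R Equate)
        (MLNStable-delete⇔ (AllP.++⁺ shadowedT (Shadowed-vacuous a-free)) a∉X)

  delProg-MLNStable : P ≡ss Q → All (Shadowed a b) P → All (Shadowed a b) Q →
                      ∀ R X → MLNStable (delProg a P ++ R) X → MLNStable (delProg a Q ++ R) X
  delProg-MLNStable {P} {Q} P≡Q shadowedP shadowedQ R X =
    from (rename Q (All-atoms⇒AllAtoms Q ≢f-Q)) ∘
    delProg-MLNStable-a-free P≡Q shadowedP shadowedQ a-free a∉X' ∘
    to (rename P (All-atoms⇒AllAtoms P ≢f-P))
    where
    L = X ++ atoms P ++ atoms Q ++ atoms R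
    f = fresh L
    σ = swap a f
    open Renaming {σ} (swap-involutive a f)

    ≢f-X = AllP.++⁻ˡ X (fresh-≢ L)
    ≢f-PQR = AllP.++⁻ʳ X (fresh-≢ L)
    ≢f-P = AllP.++⁻ˡ (atoms P) ≢f-PQR
    ≢f-Q = AllP.++⁻ˡ (atoms Q) (AllP.++⁻ʳ (atoms P) ≢f-PQR)
    ≢f-R = AllP.++⁻ʳ (atoms Q) (AllP.++⁻ʳ (atoms P) ≢f-PQR)

    a-free : All (AllAtoms (_≢ a)) (renameProg σ R)
    a-free = AllAtoms-onLists (AllP.map⁺ ∘ All.map σx≢a) (All-atoms⇒AllAtoms R ≢f-R)
      where
      σx≢a : ∀ {x} → x ≢ f → σ x ≢ a
      σx≢a {x} x≢f σx≡a = x≢f (trans (sym (swap-involutive a f x)) (trans (cong σ σx≡a) (swap-a a f)))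

    a∉X' : a ∉ map σ X
    a∉X' = (λ f∈X → All.lookup ≢f-X f∈X refl) ∘ from (∈⇔∈-map X) ∘ subst (_∈ map σ X) (sym (swap-f a f))

    rename : ∀ T → All (AllAtoms (_≢ f)) T →
             MLNStable (delProg a T ++ R) X ⇔ MLNStable (delProg a T ++ renameProg σ R) (map σ X)
    rename T f-free =
      subst (λ A → MLNStable (delProg a T ++ R) X ⇔ MLNStable A (map σ X))
        (trans (map-++ (renameRule σ) (delProg a T) R)
               (cong (_++ renameProg σ R) (map-onLists-id {p = λ x → σ x ≡ x} map-id-local fixed)))
        (MLNStable-rename⇔ (delProg a T ++ R) X)
      where
      fixed : All (AllAtoms (λ x → σ x ≡ x)) (delProg a T)
      fixed = AllAtoms-onLists σ-fixes f-free
        where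
        σ-fixes : ∀ {S} → All (_≢ f) S → All (λ x → σ x ≡ x) (delAtom a S)
        σ-fixes {S} ≢f = All.tabulate λ x∈S' →
          let x∈S , x≢a = to (∈-delAtom⇔ S) x∈S' in swap-other a f x≢a (All.lookup ≢f x∈S)

  delProg-≡ss : P ≡ss Q → All (Shadowed a b) P → All (Shadowed a b) Q → delProg a P ≡ss delProg a Q
  delProg-≡ss {P} {Q} P≡Q shadowedP shadowedQ R X =
    ⇔.trans (LPMLNStable⇔MLNStable _ X)
      (⇔.trans (mk⇔ (delProg-MLNStable P≡Q shadowedP shadowedQ R X)
                    (delProg-MLNStable (≡ss-sym {P} {Q} P≡Q) shadowedQ shadowedP R X))
               (⇔.sym (LPMLNStable⇔MLNStable _ X)))

Shadowed-lookup : ∀ {a b} T → (∀ i → a ∈ lookup (seqS T) i → b ∈ lookup (seqS T) i) → All (Shadowed a b) T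
Shadowed-lookup [] _ = []
Shadowed-lookup (r ∷ T) a⇒b =
  (a⇒b zero , a⇒b (suc zero) , a⇒b (suc (suc zero))) ∷ Shadowed-lookup T (λ i → a⇒b (suc (suc (suc i))))

InIndep⇒Shadowed : ∀ {T N' a b} → InIndep T N' a → InIndep T N' b → All (Shadowed a b) T
InIndep⇒Shadowed {T} a∈I b∈I = Shadowed-lookup T λ i → from (b∈I i) ∘ to (a∈I i)

AtLeast3⇒other : ∀ {I : Atom → Set} a → AtLeast3 I → ∃[ b ] I b × b ≢ a
AtLeast3⇒other a (b , c , _ , b∈I , c∈I , _ , b≢c , _) with b ≟ a
... | no b≢a = b , b∈I , b≢a
... | yes refl = c , c∈I , b≢c ∘ sym

take-length-map : ∀ {C D : Set} (f : C → D) xs ys → take (length xs) (map f (xs ++ ys)) ≡ map f xs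
take-length-map f [] ys = refl
take-length-map f (x ∷ xs) ys = cong (f x ∷_) (take-length-map f xs ys)

drop-length-map : ∀ {C D : Set} (f : C → D) xs ys → drop (length xs) (map f (xs ++ ys)) ≡ map f ys
drop-length-map f [] ys = refl
drop-length-map f (x ∷ xs) ys = drop-length-map f xs ys

lemma1 : (P Q : Program) → P ≡ss Q →
         (N' : Subset (length (seqS (P ++ Q)))) → Nonempty N' →
         AtLeast3 (InIndep (P ++ Q) N') →
         (a : Atom) → InIndep (P ++ Q) N' a →
         take (length P) (delProg a (P ++ Q)) ≡ss drop (length P) (delProg a (P ++ Q))
-- Only one member of I other than a is needed; Nonempty N' already follows from a ∈ I.
lemma1 P Q P≡Q N' _ atLeast3 a a∈I =
  let b , b∈I , b≢a = AtLeast3⇒other a atLeast3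
      shadowedP , shadowedQ = AllP.++⁻ P (InIndep⇒Shadowed a∈I b∈I)
  in subst₂ _≡ss_ (sym (take-length-map (delRule a) P Q)) (sym (drop-length-map (delRule a) P Q))
       (delProg-≡ss b≢a {P = P} {Q = Q} P≡Q shadowedP shadowedQ)
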